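{- Let $p,q$ be integers with $2<\frac{p}{q}<4$ and $p$ odd. Then for every vertex $v$ of $K_{p/q}$, the group $\pi_{/\sim,v}(K_{p/q})$ is isomorphic to $\mathbb{Z}$.
   Context: The circular clique $K_{p/q}$ (for integers with $p/q\ge 2$) has vertex set $\mathbb{Z}_p$ and edges $\{i,i+j\}$ for $i\in\mathbb{Z}_p$ and $j\in\{q,q+1,\dots,p-q\}$. A walk is a sequence of oriented edges, each starting where the previous ends; $WW'$ is concatenation. A square is a quadruple $v_1,\dots,v_4$ with $v_1v_2,v_2v_3,v_3v_4,v_4v_1$ edges. $\sim$ is the smallest equivalence relation on walks such that a walk is equivalent to the walk obtained by deleting any consecutive pair $e,e^{ -1}$ and $W\,v_1v_2\,v_2v_3\,W'\sim W\,v_1v_4\,v_4v_3\,W'$ for all walks $W,W'$ and squares. $\pi_{/\sim,v}(G)$ is the group of $\sim$-classes of closed walks from $v$, with product $[W]\cdot[W']=[WW']$ and inverse $[W]^{ -1}=[W^{ -1}]$. -}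

module Defs where

open import Data.Nat using (ℕ; _≤_; _∸_; _+_; NonZero)
open import Data.Nat.DivMod using (_%_)
open import Data.Fin using (Fin; toℕ)
open import Data.Integer using (ℤ) renaming (_+_ to _+ℤ_)
open import Data.Product using (Σ; _×_)
open import Relation.Binary.PropositionalEquality using (_≡_)
open import Function.Bundles using (_⇔_)

-- The circular clique K_{p/q}: vertex set ℤ_p (as Fin p), and {i, i+j mod p}
-- is an edge for j ∈ {q, …, p-q}.  Adj i k : the oriented edge i → k exists.
Adj : (p q : ℕ) → {{NonZero p}} → Fin p → Fin p → Set
Adj p q i k = Σ ℕ λ j → (q ≤ j) × (j ≤ p ∸ q) × (toℕ k ≡ (toℕ i + j) % p)

data Walk (p q : ℕ) {{_ : NonZero p}} : Fin p → Fin p → Set where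
  []  : ∀ {u} → Walk p q u u
  _∷_ : ∀ {u x w} → Adj p q u x → Walk p q x w → Walk p q u w

infixr 5 _∷_ _++_

_++_ : ∀ {p q} {{_ : NonZero p}} {u x w : Fin p} →
       Walk p q u x → Walk p q x w → Walk p q u w
[] ++ W' = W'
(e ∷ W) ++ W' = e ∷ (W ++ W')

-- ∼ : the smallest equivalence relation on walks (from u to w) containing
--   * W e e⁻¹ W' ∼ W W'   (deleting a consecutive pair e, e⁻¹)
--   * W v₁v₂ v₂v₃ W' ∼ W v₁v₄ v₄v₃ W'   for every square v₁v₂v₃v₄
data _∼_ {p q : ℕ} {{_ : NonZero p}} : {u w : Fin p} → Walk p q u w → Walk p q u w → Set where
  ∼-refl  : ∀ {u w} {W : Walk p q u w} → W ∼ W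
  ∼-sym   : ∀ {u w} {W W' : Walk p q u w} → W ∼ W' → W' ∼ W
  ∼-trans : ∀ {u w} {W₁ W₂ W₃ : Walk p q u w} → W₁ ∼ W₂ → W₂ ∼ W₃ → W₁ ∼ W₃
  ∼-cancel : ∀ {u a b w} (W : Walk p q u a) (e : Adj p q a b) (e⁻¹ : Adj p q b a)
             (W' : Walk p q a w) →
             (W ++ (e ∷ e⁻¹ ∷ W')) ∼ (W ++ W')
  ∼-square : ∀ {u v₁ v₂ v₃ v₄ w} (W : Walk p q u v₁) (W' : Walk p q v₃ w)
             (e₁₂ : Adj p q v₁ v₂) (e₂₃ : Adj p q v₂ v₃)
             (e₃₄ : Adj p q v₃ v₄) (e₄₁ : Adj p q v₄ v₁)
             (e₁₄ : Adj p q v₁ v₄) (e₄₃ : Adj p q v₄ v₃) →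
             (W ++ (e₁₂ ∷ e₂₃ ∷ W')) ∼ (W ++ (e₁₄ ∷ e₄₃ ∷ W'))

-- π_{/∼,v}(K_{p/q}) ≅ ℤ : a group isomorphism from the group of ∼-classes of
-- closed walks at v (product = concatenation) onto (ℤ, +), given as a map on
-- representatives that is well defined and injective on classes
-- (W ∼ W' ⇔ φ W ≡ φ W'), surjective, and a homomorphism.
π∼≅ℤ : (p q : ℕ) → {{_ : NonZero p}} → Fin p → Set
π∼≅ℤ p q v =
  Σ (Walk p q v v → ℤ) λ φ →
    (∀ (W W' : Walk p q v v) → (W ∼ W') ⇔ (φ W ≡ φ W'))
    × (∀ (z : ℤ) → Σ (Walk p q v v) λ W → φ W ≡ z)
    × (∀ (W W' : Walk p q v v) → φ (W ++ W') ≡ φ W +ℤ φ W')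

-- Write p = 2m + 1, so that q ≤ m.  The isomorphism is a winding number: an edge
-- u → u + j (q ≤ j ≤ p − q) counts +1 if it passes the point 0 of ℤ_p ("wraps") and −1
-- otherwise.  The
--     winding number is additive under concatenation.
--   * Circular.Winding (p < 4q): a backtrack e e⁻¹ wraps exactly once and both sides of a
--     square wrap equally often, so the winding number is invariant under ∼.
--   * OddCycle (p = 2m + 1, q ≤ m): the edges of length m + 1 and m form an odd cycle C_p.
--     Every walk is ∼ to a straight walk along C_p: an edge is rerouted through a square
--     into two cycle steps and an edge one unit closer to a cycle step, and opposite
--     cycle steps cancel.
--   * OddCycle.Classification (p < 4q): p times the winding number of a closed straight
--     walk of n steps is ±n, so straight closed walks are determined by their winding
--     number.  Hence W ∼ W' iff their winding numbers agree, and walking k times around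
--     C_p realises every integer.

module Submission where

open import Defs
open import Data.Nat using (ℕ; zero; suc; _+_; _*_; _∸_; _≤_; _<_; z≤n; s≤s; _≤?_; _<?_; NonZero)
open import Data.Nat.Properties
open import Data.Nat.DivMod using (_%_; _/_; m≡m%n+[m/n]*n; m%n<n; m%n%n≡m%n; %-distribˡ-+; [m+kn]%n≡m%n; m<n⇒m%n≡m; [m+n]%n≡m%n)
open import Data.Fin using (Fin; toℕ; fromℕ<)
open import Data.Fin.Properties using (toℕ-fromℕ<; toℕ-injective; toℕ<n)
open import Data.Product using (Σ; _×_; _,_; proj₁; proj₂)
open import Data.Sum using (_⊎_; inj₁; inj₂)
open import Function.Bundles using (mk⇔)
open import Relation.Nullary using (yes; no)
open import Data.Empty using (⊥; ⊥-elim)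
open import Relation.Binary.Definitions using (tri<; tri≈; tri>)
open import Relation.Binary.PropositionalEquality
  using (_≡_; refl; sym; trans; cong; cong₂; subst; subst₂; module ≡-Reasoning)
open import Data.Nat.Tactic.RingSolver using (solve-∀)
open import Data.Integer as Z using (ℤ; -[1+_]) renaming (+_ to pos)
import Data.Integer.Properties as ZP
import Data.Integer.Tactic.RingSolver as ℤ-Ring

sole-multiple : ∀ p k J → p * k ≡ J → 0 < J → J < p + p → k ≡ 1
sole-multiple p zero J p*0≡J 0<J _ = ⊥-elim (<⇒≢ 0<J (trans (sym (*-zeroʳ p)) p*0≡J))
sole-multiple p (suc zero) J _ _ _ = refl
sole-multiple p (suc (suc k)) J p*k≡J _ J<2p = ⊥-elim (<⇒≱ J<2p (begin
  p + p           ≡⟨ trans (*-comm p 2) (cong (p +_) (+-identityʳ p)) ⟨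
  p * 2           ≤⟨ *-monoʳ-≤ p (s≤s (s≤s z≤n)) ⟩
  p * suc (suc k) ≡⟨ p*k≡J ⟩
  J               ∎))
  where open ≤-Reasoning

multiples-apart : ∀ p a c s s' J K → c + p * s ≡ a + J → c + p * s' ≡ a + K → s < s' → J + p ≤ K
multiples-apart p a c s s' J K ≡a+J ≡a+K s<s' = +-cancelˡ-≤ a _ _ (begin
  a + (J + p)     ≡⟨ +-assoc a J p ⟨
  a + J + p       ≡⟨ cong (_+ p) ≡a+J ⟨
  c + p * s + p   ≡⟨ regroup c p s ⟩
  c + p * suc s   ≤⟨ +-monoʳ-≤ c (*-monoʳ-≤ p s<s') ⟩
  c + p * s'      ≡⟨ ≡a+K ⟩
  a + K           ∎)
  where
  open ≤-Reasoning
  regroup : ∀ c p s → c + p * s + p ≡ c + p * suc s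
  regroup = solve-∀

module Circular (p q : ℕ) {{_ : NonZero p}} (q≤p : q ≤ p) where

  V : Set
  V = Fin p

  E : V → V → Set
  E = Adj p q

  Wk : V → V → Set
  Wk = Walk p q

  Admissible : ℕ → Set
  Admissible c = q ≤ c × c + q ≤ p

  length : ∀ {u x} → E u x → ℕ
  length = proj₁

  length-admissible : ∀ {u x} (e : E u x) → Admissible (length e)
  length-admissible (j , q≤j , j≤p∸q , _) = q≤j , m≤o∸n⇒m+n≤o j q≤p j≤p∸q

  -- Positions on the cycle ℤ_p, measured from a base U: At U a x says x = U + a (mod p).
  -- (A record, so that U and a can be inferred from the type.)
  record At (U a : ℕ) (x : V) : Set where
    constructor at
    field position : toℕ x ≡ (U + a) % p

  at-target : ∀ {u x} (e : E u x) → At (toℕ u) (length e) x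
  at-target (_ , _ , _ , x≡u+j) = at x≡u+j

  at-origin : (u : V) → At (toℕ u) 0 u
  at-origin u = at (sym (trans (cong (_% p) (+-identityʳ (toℕ u))) (m<n⇒m%n≡m (toℕ<n u))))

  at-unique : ∀ {U a x y} → At U a x → At U a y → x ≡ y
  at-unique (at x≡) (at y≡) = toℕ-injective (trans x≡ (sym y≡))

  at-+ : ∀ {U a} {x : V} c → At U a x → (toℕ x + c) % p ≡ (U + (a + c)) % p
  at-+ {U} {a} {x} c (at x≡) = begin
    (toℕ x + c) % p               ≡⟨ cong (λ t → (t + c) % p) x≡ ⟩
    ((U + a) % p + c) % p         ≡⟨ %-distribˡ-+ ((U + a) % p) c p ⟩
    ((U + a) % p % p + c % p) % p ≡⟨ cong (λ t → (t + c % p) % p) (m%n%n≡m%n (U + a) p) ⟩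
    ((U + a) % p + c % p) % p     ≡⟨ %-distribˡ-+ (U + a) c p ⟨
    (U + a + c) % p               ≡⟨ cong (_% p) (+-assoc U a c) ⟩
    (U + (a + c)) % p             ∎
    where open ≡-Reasoning

  offset-mod : ∀ U {a b} k → a ≡ b + k * p → (U + a) % p ≡ (U + b) % p
  offset-mod U {a} {b} k a≡ = begin
    (U + a) % p         ≡⟨ cong (λ t → (U + t) % p) a≡ ⟩
    (U + (b + k * p)) % p ≡⟨ cong (_% p) (+-assoc U b (k * p)) ⟨
    (U + b + k * p) % p ≡⟨ [m+kn]%n≡m%n (U + b) k p ⟩
    (U + b) % p         ∎
    where open ≡-Reasoning

  at-step : ∀ {U a c} {x y : V} → At U a x → At (toℕ x) c y → At U (a + c) y
  at-step {c = c} x≡ (at y≡) = at (trans y≡ (at-+ c x≡))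

  at-cong : ∀ {U a b x} → a ≡ b → At U a x → At U b x
  at-cong refl x≡ = x≡

  at-shift : ∀ {U a b x} k → a ≡ b + k * p → At U a x → At U b x
  at-shift {U} k a≡ (at x≡) = at (trans x≡ (offset-mod U k a≡))

  at-edge : ∀ {U a b} {x y : V} c k → At U a x → At U b y → a + c ≡ b + k * p → Admissible c → E x y
  at-edge {U} c k x≡ (at y≡) a+c≡ (q≤c , c+q≤p) =
    c , q≤c , m+n≤o⇒m≤o∸n c c+q≤p , trans y≡ (sym (trans (at-+ c x≡) (offset-mod U k a+c≡)))

  _⊕_ : V → ℕ → V
  u ⊕ c = fromℕ< (m%n<n (toℕ u + c) p)

  edge-from : (u : V) (c : ℕ) → Admissible c → E u (u ⊕ c)
  edge-from u c (q≤c , c+q≤p) = c , q≤c , m+n≤o⇒m≤o∸n c c+q≤p , toℕ-fromℕ< _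

  edge-irrelevant : ∀ {u x} (e e' : E u x) → length e ≡ length e' → e ≡ e'
  edge-irrelevant (j , a , b , c) (.j , a' , b' , c') refl
    rewrite ≤-irrelevant a a' | ≤-irrelevant b b' | ≡-irrelevant c c' = refl

  ∷-cong : ∀ {u x w} (e : E u x) {W W' : Wk x w} → W ∼ W' → (e ∷ W) ∼ (e ∷ W')
  ∷-cong e ∼-refl = ∼-refl
  ∷-cong e (∼-sym r) = ∼-sym (∷-cong e r)
  ∷-cong e (∼-trans r r') = ∼-trans (∷-cong e r) (∷-cong e r')
  ∷-cong e (∼-cancel X a b Y) = ∼-cancel (e ∷ X) a b Y
  ∷-cong e (∼-square X Y a b c d f g) = ∼-square (e ∷ X) Y a b c d f g

  -- Detour through a square u x y z: go out and back along x → y → x, then replace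
  -- u → x → y by u → z → y.
  detour : ∀ {u x y z w} (e : E u x) (e' : E x y) (f : E y x)
           (e₁₄ : E u z) (e₄₃ : E z y) (e₃₄ : E y z) (e₄₁ : E z u) (T : Wk x w) →
           (e ∷ T) ∼ (e₁₄ ∷ e₄₃ ∷ f ∷ T)
  detour e e' f e₁₄ e₄₃ e₃₄ e₄₁ T =
    ∼-trans (∼-sym (∼-cancel (e ∷ []) e' f T)) (∼-square [] (f ∷ T) e e' e₃₄ e₄₁ e₁₄ e₄₃)

  data Steps (d : ℕ) : ∀ {u w} → Wk u w → ℕ → Set where
    stop : ∀ {u} → Steps d ([] {u = u}) 0
    step : ∀ {u x w} (e : E u x) {W : Wk x w} {n} → length e ≡ d → Steps d W n → Steps d (e ∷ W) (suc n)

  steps-unique : ∀ {d u w n} {T T' : Wk u w} → Steps d T n → Steps d T' n → T ≡ T'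
  steps-unique stop stop = refl
  steps-unique (step e refl s) (step e' refl s') with at-unique (at-target e) (at-target e')
  ... | refl = cong₂ _∷_ (edge-irrelevant e e' refl) (steps-unique s s')

  steps-zero : ∀ {d v} {T : Wk v v} → Steps d T 0 → T ≡ []
  steps-zero stop = refl

  line : ∀ d → Admissible d → ∀ n (u : V) → Σ V λ w → Σ (Wk u w) λ T → Steps d T n × At (toℕ u) (d * n) w
  line d adm zero u = u , [] , stop , at-cong (sym (*-zeroʳ d)) (at-origin u)
  line d adm (suc n) u with line d adm n (u ⊕ d)
  ... | w , T , s , w-at = w , edge-from u d adm ∷ T , step _ refl s ,
        at-cong (sym (*-suc d n)) (at-step (at-target (edge-from u d adm)) w-at)

  loop : ∀ d → Admissible d → ∀ k (v : V) → Σ (Wk v v) λ T → Steps d T (k * p)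
  loop d adm k v with line d adm (k * p) v
  ... | w , T , s , w-at = close (at-unique (at-shift (d * k) d*[k*p] w-at) (at-origin v)) T s
    where
    d*[k*p] : d * (k * p) ≡ 0 + d * k * p
    d*[k*p] = sym (*-assoc d k p)
    close : ∀ {w n} → w ≡ v → (T : Wk v w) → Steps d T n → Σ (Wk v v) λ T → Steps d T n
    close refl T s = T , s

  wrap : ∀ {u x} → E u x → ℕ
  wrap {u} e with toℕ u + length e <? p
  ... | yes _ = 0
  ... | no _ = 1

  wrap-spec : ∀ {u x} (e : E u x) → toℕ x + p * wrap e ≡ toℕ u + length e
  wrap-spec {u} {x} e with toℕ u + length e <? p
  ... | yes u+j<p = begin
    toℕ x + p * 0       ≡⟨ cong (toℕ x +_) (*-zeroʳ p) ⟩
    toℕ x + 0           ≡⟨ +-identityʳ (toℕ x) ⟩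
    toℕ x               ≡⟨ At.position (at-target e) ⟩
    (toℕ u + j) % p     ≡⟨ m<n⇒m%n≡m u+j<p ⟩
    toℕ u + j           ∎
    where
    open ≡-Reasoning
    j = length e
  ... | no u+j≮p = begin
    toℕ x + p * 1       ≡⟨ cong (toℕ x +_) (*-identityʳ p) ⟩
    toℕ x + p           ≡⟨ cong (_+ p) (At.position (at-target e)) ⟩
    (toℕ u + j) % p + p ≡⟨ cong (λ t → t % p + p) r+p≡ ⟨
    (r + p) % p + p     ≡⟨ cong (_+ p) ([m+n]%n≡m%n r p) ⟩
    r % p + p           ≡⟨ cong (_+ p) (m<n⇒m%n≡m r<p) ⟩
    r + p               ≡⟨ r+p≡ ⟩
    toℕ u + j           ∎
    where
    open ≡-Reasoning
    j = length e
    r = toℕ u + j ∸ p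
    r+p≡ : r + p ≡ toℕ u + j
    r+p≡ = m∸n+n≡m (≮⇒≥ u+j≮p)
    r<p : r < p
    r<p = +-cancelʳ-< p r p (subst (_< p + p) (sym r+p≡)
            (+-mono-<-≤ (toℕ<n u) (≤-trans (m≤m+n j q) (proj₂ (length-admissible e)))))

  wraps : ∀ {u w} → Wk u w → ℕ
  wraps [] = 0
  wraps (e ∷ W) = wrap e + wraps W

  span : ∀ {u w} → Wk u w → ℕ
  span [] = 0
  span (e ∷ W) = length e + span W

  #edges : ∀ {u w} → Wk u w → ℕ
  #edges [] = 0
  #edges (e ∷ W) = suc (#edges W)

  telescope : ∀ {u w} (W : Wk u w) → toℕ w + p * wraps W ≡ toℕ u + span W
  telescope {u} [] = cong (toℕ u +_) (*-zeroʳ p)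
  telescope {u} {w} (_∷_ {x = x} e W) = begin
    toℕ w + p * (wrap e + wraps W)           ≡⟨ cong (toℕ w +_) (*-distribˡ-+ p (wrap e) (wraps W)) ⟩
    toℕ w + (p * wrap e + p * wraps W)       ≡⟨ regroup (toℕ w) (p * wrap e) (p * wraps W) ⟩
    (toℕ w + p * wraps W) + p * wrap e       ≡⟨ cong (_+ p * wrap e) (telescope W) ⟩
    (toℕ x + span W) + p * wrap e            ≡⟨ swap (toℕ x) (span W) (p * wrap e) ⟩
    (toℕ x + p * wrap e) + span W            ≡⟨ cong (_+ span W) (wrap-spec e) ⟩
    (toℕ u + length e) + span W              ≡⟨ +-assoc (toℕ u) (length e) (span W) ⟩
    toℕ u + (length e + span W)              ∎
    where
    open ≡-Reasoning
    regroup : ∀ a b c → a + (b + c) ≡ (a + c) + b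
    regroup = solve-∀
    swap : ∀ a b c → (a + b) + c ≡ (a + c) + b
    swap = solve-∀

  closed-telescope : ∀ {v} (W : Wk v v) → p * wraps W ≡ span W
  closed-telescope {v} W = +-cancelˡ-≡ (toℕ v) _ _ (telescope W)

  steps-span : ∀ {d u w n} {T : Wk u w} → Steps d T n → span T ≡ d * n
  steps-span {d} stop = sym (*-zeroʳ d)
  steps-span {d} (step e {n = n} refl s) = trans (cong (d +_) (steps-span s)) (sym (*-suc d n))

  steps-#edges : ∀ {d u w n} {T : Wk u w} → Steps d T n → #edges T ≡ n
  steps-#edges stop = refl
  steps-#edges (step e _ s) = cong suc (steps-#edges s)

  weight : ∀ {u x} → E u x → ℤ
  weight e = (pos (wrap e) Z.+ pos (wrap e)) Z.- pos 1

  winding : ∀ {u w} → Wk u w → ℤ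
  winding [] = pos 0
  winding (e ∷ W) = weight e Z.+ winding W

  winding-++ : ∀ {u x w} (W : Wk u x) (W' : Wk x w) → winding (W ++ W') ≡ winding W Z.+ winding W'
  winding-++ [] W' = sym (ZP.+-identityˡ (winding W'))
  winding-++ (e ∷ W) W' =
    trans (cong (Z._+_ (weight e)) (winding-++ W W')) (sym (ZP.+-assoc (weight e) (winding W) (winding W')))

  winding-closed-form : ∀ {u w} (W : Wk u w) → winding W ≡ (pos (wraps W) Z.+ pos (wraps W)) Z.- pos (#edges W)
  winding-closed-form [] = refl
  winding-closed-form (e ∷ W) = begin
    weight e Z.+ winding W
      ≡⟨ cong (Z._+_ (weight e)) (winding-closed-form W) ⟩
    ((pos a Z.+ pos a) Z.- pos 1) Z.+ ((pos b Z.+ pos b) Z.- pos n)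
      ≡⟨ collect (pos a) (pos b) (pos n) ⟩
    ((pos a Z.+ pos b) Z.+ (pos a Z.+ pos b)) Z.- (pos 1 Z.+ pos n)
      ≡⟨ cong₂ (λ s t → (s Z.+ s) Z.- t) (ZP.pos-+ a b) (ZP.pos-+ 1 n) ⟨
    (pos (a + b) Z.+ pos (a + b)) Z.- pos (suc n)
      ∎
    where
    open ≡-Reasoning
    a = wrap e
    b = wraps W
    n = #edges W
    collect : ∀ A B N → ((A Z.+ A) Z.- pos 1) Z.+ ((B Z.+ B) Z.- N) ≡ ((A Z.+ B) Z.+ (A Z.+ B)) Z.- (pos 1 Z.+ N)
    collect = ℤ-Ring.solve-∀

  winding-steps : ∀ {v d n} {T : Wk v v} → Steps d T n → pos p Z.* winding T ≡ pos n Z.* ((pos d Z.+ pos d) Z.- pos p)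
  winding-steps {v} {d} {n} {T} s = begin
    pos p Z.* winding T
      ≡⟨ cong (Z._*_ (pos p)) (trans (winding-closed-form T)
           (cong (λ k → (pos (wraps T) Z.+ pos (wraps T)) Z.- pos k) (steps-#edges s))) ⟩
    pos p Z.* ((pos (wraps T) Z.+ pos (wraps T)) Z.- pos n)
      ≡⟨ expand (pos p) (pos (wraps T)) (pos n) ⟩
    (pos p Z.* pos (wraps T) Z.+ pos p Z.* pos (wraps T)) Z.- pos p Z.* pos n
      ≡⟨ cong (λ t → (t Z.+ t) Z.- pos p Z.* pos n) p·wraps ⟩
    (pos d Z.* pos n Z.+ pos d Z.* pos n) Z.- pos p Z.* pos n
      ≡⟨ factor (pos p) (pos d) (pos n) ⟩
    pos n Z.* ((pos d Z.+ pos d) Z.- pos p)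
      ∎
    where
    open ≡-Reasoning
    p·wraps : pos p Z.* pos (wraps T) ≡ pos d Z.* pos n
    p·wraps = trans (sym (ZP.pos-* p (wraps T)))
                (trans (cong pos (trans (closed-telescope T) (steps-span s))) (ZP.pos-* d n))
    expand : ∀ P W N → P Z.* ((W Z.+ W) Z.- N) ≡ (P Z.* W Z.+ P Z.* W) Z.- P Z.* N
    expand = ℤ-Ring.solve-∀
    factor : ∀ P D N → (D Z.* N Z.+ D Z.* N) Z.- P Z.* N ≡ N Z.* ((D Z.+ D) Z.- P)
    factor = ℤ-Ring.solve-∀

  weight-pair : ∀ {a b c} (e : E a b) (e' : E b c) →
                weight e Z.+ weight e' ≡ (pos (wrap e + wrap e') Z.+ pos (wrap e + wrap e')) Z.- pos 2
  weight-pair e e' = trans (collect (pos (wrap e)) (pos (wrap e')))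
                       (cong (λ s → (s Z.+ s) Z.- pos 2) (sym (ZP.pos-+ (wrap e) (wrap e'))))
    where
    collect : ∀ A B → ((A Z.+ A) Z.- pos 1) Z.+ ((B Z.+ B) Z.- pos 1) ≡ ((A Z.+ B) Z.+ (A Z.+ B)) Z.- pos 2
    collect = ℤ-Ring.solve-∀

  winding-split : ∀ {u a b c w} (X : Wk u a) (e : E a b) (e' : E b c) (Y : Wk c w) →
                  winding (X ++ (e ∷ e' ∷ Y)) ≡ winding X Z.+ ((weight e Z.+ weight e') Z.+ winding Y)
  winding-split X e e' Y = trans (winding-++ X (e ∷ e' ∷ Y))
    (cong (Z._+_ (winding X)) (sym (ZP.+-assoc (weight e) (weight e') (winding Y))))

  -- For p < 4q the winding number is an invariant of ∼: a backtrack e e⁻¹ wraps exactly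
  -- once, and the two sides of a square wrap equally often.
  module Winding (p<4q : p < 4 * q) where

    1≤q : 1 ≤ q
    1≤q = positive q p<4q
      where
      positive : ∀ r → p < 4 * r → 1 ≤ r
      positive zero p<0 = ⊥-elim (n≮0 p<0)
      positive (suc _) _ = s≤s z≤n

    two-edges : ∀ {a b c} (e : E a b) (e' : E b c) →
                q + q ≤ length e + length e' × (length e + length e') + (q + q) ≤ p + p
    two-edges e e' with length-admissible e | length-admissible e'
    ... | q≤j , j+q≤p | q≤j' , j'+q≤p =
      +-mono-≤ q≤j q≤j' , subst (_≤ p + p) (regroup (length e) (length e') q) (+-mono-≤ j+q≤p j'+q≤p)
      where
      regroup : ∀ j j' q → (j + q) + (j' + q) ≡ (j + j') + (q + q)
      regroup = solve-∀

    telescope₂ : ∀ {a b c} (e : E a b) (e' : E b c) →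
                 toℕ c + p * (wrap e + wrap e') ≡ toℕ a + (length e + length e')
    telescope₂ {a} {c = c} e e' = subst₂ (λ s t → toℕ c + p * (wrap e + s) ≡ toℕ a + (length e + t))
                        (+-identityʳ (wrap e')) (+-identityʳ (length e')) (telescope (e ∷ e' ∷ []))

    -- Going out and back covers a multiple of p strictly between 0 and 2p: one wrap.
    wrap-backtrack : ∀ {u x} (e : E u x) (e' : E x u) → wrap e + wrap e' ≡ 1
    wrap-backtrack {u} e e' with two-edges e e'
    ... | 2q≤J , J+2q≤2p = sole-multiple p (wrap e + wrap e') J
      (+-cancelˡ-≡ (toℕ u) _ _ (telescope₂ e e'))
      (≤-trans 1≤2q 2q≤J)
      (≤-trans (≤-trans (≤-reflexive (+-comm 1 J)) (+-monoʳ-≤ J 1≤2q)) J+2q≤2p)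
      where
      J = length e + length e'
      1≤2q : 1 ≤ q + q
      1≤2q = ≤-trans 1≤q (m≤m+n q q)

    too-far : ∀ {a b c d} (e₁₂ : E a b) (e₂₃ : E b c) (e₁₄ : E a d) (e₄₃ : E d c) →
              (length e₁₂ + length e₂₃) + p ≤ length e₁₄ + length e₄₃ → ⊥
    too-far {a} {b} {c} {d} e₁₂ e₂₃ e₁₄ e₄₃ J+p≤K with two-edges e₁₂ e₂₃ | two-edges e₁₄ e₄₃
    ... | 2q≤J , _ | _ , K+2q≤2p = <⇒≱ p<4q (+-cancelʳ-≤ p _ _ (begin
      4 * q + p             ≡⟨ regroup q p ⟩
      (q + q) + p + (q + q) ≤⟨ +-monoˡ-≤ (q + q) (+-monoˡ-≤ p 2q≤J) ⟩
      J + p + (q + q)       ≤⟨ +-monoˡ-≤ (q + q) J+p≤K ⟩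
      K + (q + q)           ≤⟨ K+2q≤2p ⟩
      p + p                 ∎))
      where
      open ≤-Reasoning
      J = length e₁₂ + length e₂₃
      K = length e₁₄ + length e₄₃
      regroup : ∀ q p → 4 * q + p ≡ (q + q) + p + (q + q)
      regroup = solve-∀

    wrap-square : ∀ {a b c d} (e₁₂ : E a b) (e₂₃ : E b c) (e₁₄ : E a d) (e₄₃ : E d c) →
                  wrap e₁₂ + wrap e₂₃ ≡ wrap e₁₄ + wrap e₄₃
    wrap-square {a} {b} {c} {d} e₁₂ e₂₃ e₁₄ e₄₃ with <-cmp (wrap e₁₂ + wrap e₂₃) (wrap e₁₄ + wrap e₄₃)
    ... | tri≈ _ s≡s' _ = s≡s'
    ... | tri< s<s' _ _ = ⊥-elim (too-far e₁₂ e₂₃ e₁₄ e₄₃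
          (multiples-apart p (toℕ a) (toℕ c) _ _ _ _ (telescope₂ e₁₂ e₂₃) (telescope₂ e₁₄ e₄₃) s<s'))
    ... | tri> _ _ s>s' = ⊥-elim (too-far e₁₄ e₄₃ e₁₂ e₂₃
          (multiples-apart p (toℕ a) (toℕ c) _ _ _ _ (telescope₂ e₁₄ e₄₃) (telescope₂ e₁₂ e₂₃) s>s'))

    winding-invariant : ∀ {u w} {W W' : Wk u w} → W ∼ W' → winding W ≡ winding W'
    winding-invariant ∼-refl = refl
    winding-invariant (∼-sym r) = sym (winding-invariant r)
    winding-invariant (∼-trans r r') = trans (winding-invariant r) (winding-invariant r')
    winding-invariant (∼-cancel X e e' Y) = begin
      winding (X ++ (e ∷ e' ∷ Y))                         ≡⟨ winding-split X e e' Y ⟩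
      winding X Z.+ ((weight e Z.+ weight e') Z.+ winding Y)
        ≡⟨ cong (λ t → winding X Z.+ (t Z.+ winding Y)) (trans (weight-pair e e')
             (cong (λ s → (pos s Z.+ pos s) Z.- pos 2) (wrap-backtrack e e'))) ⟩
      winding X Z.+ (pos 0 Z.+ winding Y)                 ≡⟨ cong (Z._+_ (winding X)) (ZP.+-identityˡ (winding Y)) ⟩
      winding X Z.+ winding Y                             ≡⟨ winding-++ X Y ⟨
      winding (X ++ Y)                                    ∎
      where open ≡-Reasoning
    winding-invariant (∼-square X Y e₁₂ e₂₃ _ _ e₁₄ e₄₃) = begin
      winding (X ++ (e₁₂ ∷ e₂₃ ∷ Y))                              ≡⟨ winding-split X e₁₂ e₂₃ Y ⟩
      winding X Z.+ ((weight e₁₂ Z.+ weight e₂₃) Z.+ winding Y)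
        ≡⟨ cong (λ t → winding X Z.+ (t Z.+ winding Y)) (trans (weight-pair e₁₂ e₂₃)
             (trans (cong (λ s → (pos s Z.+ pos s) Z.- pos 2) (wrap-square e₁₂ e₂₃ e₁₄ e₄₃))
               (sym (weight-pair e₁₄ e₄₃)))) ⟩
      winding X Z.+ ((weight e₁₄ Z.+ weight e₄₃) Z.+ winding Y)   ≡⟨ winding-split X e₁₄ e₄₃ Y ⟨
      winding (X ++ (e₁₄ ∷ e₄₃ ∷ Y))                              ∎
      where open ≡-Reasoning

-- The odd circular clique K_{p/q} with p = 2m + 1 and q ≤ m.  It contains the odd
-- cycle C_p whose steps have length m + 1 forward and m backward.
module OddCycle (p : ℕ) {{_ : NonZero p}} (m q : ℕ) (p≡2m+1 : p ≡ suc (m + m)) (q≤m : q ≤ m) where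

  m+q≤p : m + q ≤ p
  m+q≤p = ≤-trans (+-monoʳ-≤ m q≤m) (≤-trans (n≤1+n (m + m)) (≤-reflexive (sym p≡2m+1)))

  q≤p : q ≤ p
  q≤p = ≤-trans (m≤n+m q m) m+q≤p

  open Circular p q q≤p

  data Dir : Set where
    fwd bwd : Dir

  opposite : Dir → Dir
  opposite fwd = bwd
  opposite bwd = fwd

  stepLen : Dir → ℕ
  stepLen fwd = suc m
  stepLen bwd = m

  stepLen-opposite : ∀ δ → stepLen δ + stepLen (opposite δ) ≡ p
  stepLen-opposite fwd = sym p≡2m+1
  stepLen-opposite bwd = trans (+-suc m m) (sym p≡2m+1)

  stepLen-admissible : ∀ δ → Admissible (stepLen δ)
  stepLen-admissible fwd = ≤-trans q≤m (n≤1+n m) , ≤-trans (s≤s (+-monoʳ-≤ m q≤m)) (≤-reflexive (sym p≡2m+1))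
  stepLen-admissible bwd = q≤m , m+q≤p

  Straight : ∀ {u w} → Wk u w → Set
  Straight T = Σ Dir λ δ → Σ ℕ λ n → Steps (stepLen δ) T n

  Reduces : ∀ {u w} → Wk u w → Set
  Reduces {u} {w} W = Σ (Wk u w) λ T → Straight T × (W ∼ T)

  ∼-reduces : ∀ {u w} {W W' : Wk u w} → W ∼ W' → Reduces W' → Reduces W
  ∼-reduces W∼W' (T , s , W'∼T) = T , s , ∼-trans W∼W' W'∼T

  step-back : ∀ δ {u x y} (e : E u x) (f : E x y) →
              length e ≡ stepLen δ → length f ≡ stepLen (opposite δ) → y ≡ u
  step-back δ {u} e f e-len f-len = at-unique
    (at-shift 1 (trans (stepLen-opposite δ) (sym (+-identityʳ p)))
      (at-step (at-cong e-len (at-target e)) (at-cong f-len (at-target f))))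
    (at-origin u)

  turn-back : ∀ δ {u x w n} (e : E u x) → length e ≡ stepLen δ → {T : Wk x w} →
              Steps (stepLen (opposite δ)) T n → Reduces (e ∷ T)
  turn-back δ e e-len stop = e ∷ [] , (δ , 1 , step e e-len stop) , ∼-refl
  turn-back δ {u} {x} e e-len (step f {T} f-len s) with step-back δ {u} e f e-len f-len
  ... | refl = T , (opposite δ , _ , s) , ∼-cancel {a = u} {b = x} [] e f T

  prepend : ∀ δ {u x w} (e : E u x) → length e ≡ stepLen δ → (T : Wk x w) → Straight T → Reduces (e ∷ T)
  prepend fwd e e-len T (fwd , n , s) = e ∷ T , (fwd , suc n , step e e-len s) , ∼-refl
  prepend bwd e e-len T (bwd , n , s) = e ∷ T , (bwd , suc n , step e e-len s) , ∼-refl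
  prepend fwd e e-len T (bwd , n , s) = turn-back fwd e e-len s
  prepend bwd e e-len T (fwd , n , s) = turn-back bwd e e-len s

  prepend-reduces : ∀ δ {u x w} (e : E u x) → length e ≡ stepLen δ → {W : Wk x w} → Reduces W → Reduces (e ∷ W)
  prepend-reduces δ e e-len (T , s , W∼T) = ∼-reduces (∷-cong e W∼T) (prepend δ e e-len T s)

  -- Toward δ d k: the edge length d is k unit moves away from the step length of δ
  -- (beyond it for fwd, short of it for bwd).
  Toward : Dir → ℕ → ℕ → Set
  Toward fwd d k = d ≡ suc m + k
  Toward bwd d k = d + k ≡ m

  toward-zero : ∀ δ {d} → Toward δ d 0 → d ≡ stepLen δ
  toward-zero fwd d≡ = trans d≡ (+-identityʳ (suc m))
  toward-zero bwd d+0≡ = trans (sym (+-identityʳ _)) d+0≡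

  direction : ∀ d → Σ Dir λ δ → Σ ℕ (Toward δ d)
  direction d with d ≤? m
  ... | yes d≤m = bwd , m≤n⇒∃[o]m+o≡n d≤m
  ... | no d≰m = fwd , proj₁ m<d , sym (proj₂ m<d)
    where m<d = m≤n⇒∃[o]m+o≡n (≰⇒> d≰m)

  -- The arithmetic of one rerouting step: from an edge of length d at distance k + 1
  -- from stepLen δ, go out along an edge of length `out` to the point u + 2·stepLen δ,
  -- and come back along an edge of length `back`, which is at distance k.
  record Shortcut (δ : Dir) (d k : ℕ) : Set where
    field
      out back        : ℕ
      out-sum         : d + out ≡ stepLen δ + stepLen δ
      turn            : out + back ≡ p
      out-admissible  : Admissible out
      back-admissible : Admissible back
      back-toward     : Toward δ back k

  beyond-admissible : ∀ k → k + q ≤ m → Admissible (suc m + k)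
  beyond-admissible k k+q≤m =
    ≤-trans q≤m (≤-trans (n≤1+n m) (m≤m+n (suc m) k)) ,
    ≤-trans (≤-reflexive (+-assoc (suc m) k q)) (≤-trans (s≤s (+-monoʳ-≤ m k+q≤m)) (≤-reflexive (sym p≡2m+1)))

  shortcut-fwd : ∀ d k → Admissible d → Toward fwd d (suc k) → Shortcut fwd d k
  shortcut-fwd d k (q≤d , d+q≤p) refl = record
    { out = o ; back = suc m + k
    ; out-sum = trans (+-assoc (suc m) (suc k) o) (cong (λ t → suc m + suc t) k+o≡m)
    ; turn = trans (regroup o m k) (trans (cong (λ t → suc (m + t)) k+o≡m) (sym p≡2m+1))
    ; out-admissible = +-cancelˡ-≤ k q o (≤-trans (≤-trans (+-monoʳ-≤ k (n≤1+n q)) (≤-reflexive (+-suc k q)))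
                         (≤-trans k+q<m (≤-reflexive (sym k+o≡m))))
                       , ≤-trans (+-monoˡ-≤ q (m∸n≤m m k)) m+q≤p
    ; back-admissible = beyond-admissible k (≤-trans (n≤1+n (k + q)) k+q<m)
    ; back-toward = refl
    }
    where
    o = m ∸ k
    -- Admissibility of d = m + 1 + (k + 1) forces k + q < m.
    k+q<m : suc (k + q) ≤ m
    k+q<m = +-cancelˡ-≤ m _ _ (≤-pred (≤-trans (≤-reflexive (sym (+-assoc (suc m) (suc k) q)))
              (≤-trans d+q≤p (≤-reflexive p≡2m+1))))
    k+o≡m : k + o ≡ m
    k+o≡m = m+[n∸m]≡n (≤-trans (m≤m+n k q) (≤-trans (n≤1+n (k + q)) k+q<m))
    regroup : ∀ o m k → o + (suc m + k) ≡ suc (m + (k + o))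
    regroup = solve-∀

  shortcut-bwd : ∀ d k → Admissible d → Toward bwd d (suc k) → Shortcut bwd d k
  shortcut-bwd d k (q≤d , _) d+k+1≡m = record
    { out = suc m + k ; back = suc d
    ; out-sum = trans (regroup₁ d m k) (cong (m +_) d+k+1≡m)
    ; turn = trans (regroup₂ d m k) (trans (cong (λ t → suc (m + t)) d+k+1≡m) (sym p≡2m+1))
    ; out-admissible = beyond-admissible k k+q≤m
    ; back-admissible = ≤-trans q≤d (n≤1+n d) , ≤-trans (+-monoˡ-≤ q d<m) m+q≤p
    ; back-toward = trans (sym (+-suc d k)) d+k+1≡m
    }
    where
    d<m : suc d ≤ m
    d<m = ≤-trans (s≤s (m≤m+n d k)) (≤-trans (≤-reflexive (sym (+-suc d k))) (≤-reflexive d+k+1≡m))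
    k+q≤m : k + q ≤ m
    k+q≤m = ≤-trans (+-monoʳ-≤ k q≤d) (≤-trans (≤-reflexive (+-comm k d))
              (≤-trans (+-monoʳ-≤ d (n≤1+n k)) (≤-reflexive d+k+1≡m)))
    regroup₁ : ∀ d m k → d + (suc m + k) ≡ m + (d + suc k)
    regroup₁ = solve-∀
    regroup₂ : ∀ d m k → (suc m + k) + suc d ≡ suc (m + (d + suc k))
    regroup₂ = solve-∀

  shortcut : ∀ δ d k → Admissible d → Toward δ d (suc k) → Shortcut δ d k
  shortcut fwd = shortcut-fwd
  shortcut bwd = shortcut-bwd

  plus-turn : ∀ a b c → b + c ≡ p → (a + b) + c ≡ a + 1 * p
  plus-turn a b c b+c≡p = trans (+-assoc a b c) (cong (a +_) (trans b+c≡p (sym (+-identityʳ p))))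

  record Rerouted (δ : Dir) (r : ℕ) {u x w} (e : E u x) (T : Wk x w) : Set where
    field
      {mid₁ mid₂} : V
      first       : E u mid₁
      second      : E mid₁ mid₂
      rest        : E mid₂ x
      first-len   : length first ≡ stepLen δ
      second-len  : length second ≡ stepLen δ
      rest-len    : length rest ≡ r
      rerouted    : (e ∷ T) ∼ (first ∷ second ∷ rest ∷ T)

  -- The square u x y z with y = x + out = u + 2s and z = u + s (s = stepLen δ) lets us
  -- reroute e: u → x through z and y.
  reroute : ∀ δ {k u x w} (e : E u x) (sc : Shortcut δ (length e) k) (T : Wk x w) →
            Rerouted δ (Shortcut.back sc) e T
  reroute δ {u = u} {x} e sc T = record
    { first = e₁ ; second = e₂ ; rest = f
    ; first-len = refl ; second-len = refl ; rest-len = refl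
    ; rerouted = detour e e' f e₁ e₂ e₃₄ e₄₁ T
    }
    where
    open Shortcut sc
    s = stepLen δ
    s' = stepLen (opposite δ)
    e₁ = edge-from u s (stepLen-admissible δ)
    e' = edge-from x out out-admissible
    z-at : At (toℕ u) s (u ⊕ s)
    z-at = at-target e₁
    y-at : At (toℕ u) (length e + out) (x ⊕ out)
    y-at = at-step (at-target e) (at-target e')
    y-at' : At (toℕ u) (s + s) (x ⊕ out)
    y-at' = at-cong out-sum y-at
    e₂ : E (u ⊕ s) (x ⊕ out)
    e₂ = at-edge s 0 z-at y-at' (sym (+-identityʳ (s + s))) (stepLen-admissible δ)
    -- e₃₄ and e₄₁ close the square u x y z; they are only needed as witnesses.
    e₃₄ : E (x ⊕ out) (u ⊕ s)
    e₃₄ = at-edge s' 1 y-at' z-at (plus-turn s s s' (stepLen-opposite δ)) (stepLen-admissible (opposite δ))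
    e₄₁ : E (u ⊕ s) u
    e₄₁ = at-edge s' 1 z-at (at-origin u) (plus-turn 0 s s' (stepLen-opposite δ)) (stepLen-admissible (opposite δ))
    f : E (x ⊕ out) x
    f = at-edge back 1 y-at (at-target e) (plus-turn (length e) out back turn) back-admissible

  -- Every edge, prepended to a reducible walk, gives a reducible walk: by induction on
  -- the distance of its length from a cycle step, using the rerouting square.
  reduce-edge : ∀ δ k {u x w} (e : E u x) → Toward δ (length e) k → {T : Wk x w} → Reduces T → Reduces (e ∷ T)
  reduce-edge δ zero e t red = prepend-reduces δ e (toward-zero δ t) red
  reduce-edge δ (suc k) e t {T} red =
    ∼-reduces rerouted (prepend-reduces δ first first-len (prepend-reduces δ second second-len
      (reduce-edge δ k rest (subst (λ d → Toward δ d k) (sym rest-len) back-toward) red)))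
    where
    sc = shortcut δ (length e) k (length-admissible e) t
    open Shortcut sc
    open Rerouted (reroute δ e sc T)

  reduce : ∀ {u w} (W : Wk u w) → Reduces W
  reduce [] = [] , (fwd , 0 , stop) , ∼-refl
  reduce (e ∷ W) with direction (length e)
  ... | δ , k , t = reduce-edge δ k e t (reduce W)

  module Classification (p<4q : p < 4 * q) where
    open Winding p<4q

    signed : Dir → ℕ → ℤ
    signed fwd n = pos n
    signed bwd n = Z.- pos n

    pos-p : pos p ≡ pos 1 Z.+ (pos m Z.+ pos m)
    pos-p = trans (cong pos p≡2m+1) (trans (ZP.pos-+ 1 (m + m)) (cong (Z._+_ (pos 1)) (ZP.pos-+ m m)))

    -- A forward step overshoots half a turn by 1/2, a backward step falls short by 1/2:
    -- 2 · stepLen δ − p = ±1.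
    drift : ∀ δ n → pos n Z.* ((pos (stepLen δ) Z.+ pos (stepLen δ)) Z.- pos p) ≡ signed δ n
    drift fwd n = begin
      pos n Z.* ((pos (suc m) Z.+ pos (suc m)) Z.- pos p)
        ≡⟨ cong₂ (λ a b → pos n Z.* ((a Z.+ a) Z.- b)) (ZP.pos-+ 1 m) pos-p ⟩
      pos n Z.* (((pos 1 Z.+ pos m) Z.+ (pos 1 Z.+ pos m)) Z.- (pos 1 Z.+ (pos m Z.+ pos m)))
        ≡⟨ cancel (pos n) (pos m) ⟩
      pos n ∎
      where
      open ≡-Reasoning
      cancel : ∀ N M → N Z.* (((pos 1 Z.+ M) Z.+ (pos 1 Z.+ M)) Z.- (pos 1 Z.+ (M Z.+ M))) ≡ N
      cancel = ℤ-Ring.solve-∀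
    drift bwd n = begin
      pos n Z.* ((pos m Z.+ pos m) Z.- pos p)
        ≡⟨ cong (λ b → pos n Z.* ((pos m Z.+ pos m) Z.- b)) pos-p ⟩
      pos n Z.* ((pos m Z.+ pos m) Z.- (pos 1 Z.+ (pos m Z.+ pos m)))
        ≡⟨ cancel (pos n) (pos m) ⟩
      Z.- pos n ∎
      where
      open ≡-Reasoning
      cancel : ∀ N M → N Z.* ((M Z.+ M) Z.- (pos 1 Z.+ (M Z.+ M))) ≡ Z.- N
      cancel = ℤ-Ring.solve-∀

    winding-straight : ∀ δ n {v} {T : Wk v v} → Steps (stepLen δ) T n → pos p Z.* winding T ≡ signed δ n
    winding-straight δ n s = trans (winding-steps s) (drift δ n)

    signed-agree : ∀ δ δ' n n' → signed δ n ≡ signed δ' n' → (δ ≡ δ' × n ≡ n') ⊎ (n ≡ 0 × n' ≡ 0)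
    signed-agree fwd fwd n n' eq = inj₁ (refl , ZP.+-injective eq)
    signed-agree bwd bwd n n' eq = inj₁ (refl , ZP.+-injective (ZP.neg-injective eq))
    signed-agree fwd bwd n zero eq = inj₂ (ZP.+-injective eq , refl)
    signed-agree fwd bwd n (suc _) ()
    signed-agree bwd fwd zero n' eq = inj₂ (refl , sym (ZP.+-injective eq))
    signed-agree bwd fwd (suc _) n' ()

    straight-unique : ∀ {v} {T T' : Wk v v} → Straight T → Straight T' → winding T ≡ winding T' → T ≡ T'
    straight-unique (δ , n , s) (δ' , n' , s') eq
      with signed-agree δ δ' n n' (trans (sym (winding-straight δ n s))
             (trans (cong (Z._*_ (pos p)) eq) (winding-straight δ' n' s')))
    ... | inj₁ (refl , refl) = steps-unique s s'
    ... | inj₂ (refl , refl) = trans (steps-zero s) (sym (steps-zero s'))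

    -- Equal winding numbers: both walks reduce to the same straight walk.
    winding-reflects : ∀ {v} (W W' : Wk v v) → winding W ≡ winding W' → W ∼ W'
    winding-reflects W W' eq with reduce W | reduce W'
    ... | T , s , W∼T | T' , s' , W'∼T' =
      ∼-trans W∼T (subst (_∼ W') (sym (straight-unique s s' T≈T')) (∼-sym W'∼T'))
      where
      T≈T' : winding T ≡ winding T'
      T≈T' = trans (sym (winding-invariant W∼T)) (trans eq (winding-invariant W'∼T'))

    p-times : ∀ k → pos (k * p) ≡ pos p Z.* pos k
    p-times k = trans (ZP.pos-* k p) (ZP.*-comm (pos k) (pos p))

    winding-onto : ∀ v (z : ℤ) → Σ (Wk v v) λ W → winding W ≡ z
    winding-onto v (pos k) with loop (stepLen fwd) (stepLen-admissible fwd) k v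
    ... | T , s = T , ZP.*-cancelˡ-≡ (pos p) _ _ (trans (winding-straight fwd (k * p) s) (p-times k))
    winding-onto v -[1+ k ] with loop (stepLen bwd) (stepLen-admissible bwd) (suc k) v
    ... | T , s = T , ZP.*-cancelˡ-≡ (pos p) _ _ (trans (winding-straight bwd (suc k * p) s)
                        (trans (cong Z.-_ (p-times (suc k))) (ZP.neg-distribʳ-* (pos p) (pos (suc k)))))

    isomorphism : (v : V) → π∼≅ℤ p q v
    isomorphism v = winding , (λ W W' → mk⇔ winding-invariant (winding-reflects W W')) , winding-onto v , winding-++

odd-half : ∀ p q → 2 * q < p → p % 2 ≡ 1 → Σ ℕ λ m → p ≡ suc (m + m) × q ≤ m
odd-half p q 2q<p p-odd = m , p≡2m+1 , *-cancelˡ-≤ 2 (≤-trans (≤-pred (subst (2 * q <_) p≡2m+1 2q<p))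
                                         (≤-reflexive (double m)))
  where
  m = p / 2
  double : ∀ m → m + m ≡ 2 * m
  double = solve-∀
  p≡2m+1 : p ≡ suc (m + m)
  p≡2m+1 = trans (m≡m%n+[m/n]*n p 2) (trans (cong (_+ m * 2) p-odd) (cong suc (trans (*-comm m 2) (sym (double m)))))

lemma8 : (p q : ℕ) → {{_ : NonZero p}} →
         2 * q < p → p < 4 * q → p % 2 ≡ 1 →
         (v : Fin p) → π∼≅ℤ p q v
lemma8 p q 2q<p p<4q p-odd v with odd-half p q 2q<p p-odd
... | m , p≡2m+1 , q≤m = OddCycle.Classification.isomorphism p m q p≡2m+1 q≤m p<4q v
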